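{- The types $\mathrm{SigmaOrd}$ and $\mathrm{MutualOrd}$ are equivalent (in the sense of Homotopy Type Theory), i.e. there is an element of $\mathrm{SigmaOrd} \simeq \mathrm{MutualOrd}$.
   Context: Work in cubical type theory (as implemented in cubical Agda); $x \equiv y$ denotes the path type, $A \uplus B$ the coproduct, $\Sigma$ dependent sums, $A \simeq B$ the type of equivalences. $\mathrm{Tree}$ is the inductive type with constructors $\mathbf{0} : \mathrm{Tree}$ and $\omega^{a} + b : \mathrm{Tree}$ for $a, b : \mathrm{Tree}$. The relation $a < b$ on $\mathrm{Tree}$ is the inductive family generated by: $\mathbf{0} < \omega^a + b$; if $a < c$ then $\omega^a + b < \omega^c + d$; if $a \equiv c$ and $b < d$ then $\omega^a + b < \omega^c + d$. Put $a \geq b := (b < a) \uplus (a \equiv b)$, and $\mathrm{fst}(\mathbf{0}) = \mathbf{0}$, $\mathrm{fst}(\omega^a + b) = a$. The predicate $\mathrm{isCNF}$ on $\mathrm{Tree}$ is inductively generated by: $\mathrm{isCNF}(\mathbf{0})$; and if $\mathrm{isCNF}(a)$, $\mathrm{isCNF}(b)$ and $a \geq \mathrm{fst}(b)$, then $\mathrm{isCNF}(\omega^a + b)$. Define $\mathrm{SigmaOrd} := \Sigma (a : \mathrm{Tree}).\ \mathrm{isCNF}(a)$. $\mathrm{MutualOrd} : \mathrm{Type}_0$ is defined simultaneously (inductive-inductive-recursively) with a relation $< $ on it and a function $\mathrm{fst} : \mathrm{MutualOrd} \to \mathrm{MutualOrd}$: its constructors are $\mathbf{0}$ and, for $a, b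 : \mathrm{MutualOrd}$ and $r : a \geq \mathrm{fst}(b)$, an element $\omega^a + b\,[r]$, where $a \geq b := (b < a) \uplus (a \equiv b)$. The relation $<$ is generated by: $\mathbf{0} < \omega^a + b\,[r]$; if $a < c$ then $\omega^a + b\,[r] < \omega^c + d\,[s]$; if $a \equiv c$ and $b < d$ then $\omega^a + b\,[r] < \omega^c + d\,[s]$. Finally $\mathrm{fst}(\mathbf{0}) = \mathbf{0}$ and $\mathrm{fst}(\omega^a + b\,[r]) = a$. -}

module Defs where

open import Data.Sum using (_⊎_)
open import Data.Product using (Σ)
open import Relation.Binary.PropositionalEquality using (_≡_)

data Tree : Set where
  𝟎 : Tree
  ω^_+_ : Tree → Tree → Tree

infix 30 ω^_+_

data _<ᵀ_ : Tree → Tree → Set where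
  <₁ : ∀ {a b} → 𝟎 <ᵀ ω^ a + b
  <₂ : ∀ {a b c d} → a <ᵀ c → ω^ a + b <ᵀ ω^ c + d
  <₃ : ∀ {a b c d} → a ≡ c → b <ᵀ d → ω^ a + b <ᵀ ω^ c + d

_≥ᵀ_ : Tree → Tree → Set
a ≥ᵀ b = (b <ᵀ a) ⊎ (a ≡ b)

fstᵀ : Tree → Tree
fstᵀ 𝟎 = 𝟎
fstᵀ (ω^ a + b) = a

data isCNF : Tree → Set where
  𝟎IsCNF : isCNF 𝟎
  ω^+IsCNF : ∀ {a b} → isCNF a → isCNF b → a ≥ᵀ fstᵀ b → isCNF (ω^ a + b)

SigmaOrd : Set
SigmaOrd = Σ Tree isCNF

data MutualOrd : Set
data _<_ : MutualOrd → MutualOrd → Set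
fst : MutualOrd → MutualOrd

_≥_ : MutualOrd → MutualOrd → Set
a ≥ b = (b < a) ⊎ (a ≡ b)

data MutualOrd where
  𝟎 : MutualOrd
  ω^_+_[_] : (a b : MutualOrd) → a ≥ fst b → MutualOrd

data _<_ where
  <₁ : ∀ {a b r} → 𝟎 < ω^ a + b [ r ]
  <₂ : ∀ {a b c d r s} → a < c → ω^ a + b [ r ] < ω^ c + d [ s ]
  <₃ : ∀ {a b c d r s} → a ≡ c → b < d → ω^ a + b [ r ] < ω^ c + d [ s ]

fst 𝟎 = 𝟎
fst (ω^ a + b [ _ ]) = a

module Submission where

-- Both types describe ordinals below ε₀ in Cantor normal form: SigmaOrd pairs
-- a tree with a proof that it is in normal form, MutualOrd builds the
-- normal-form condition into its constructor.  The equivalence forgets,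
-- respectively rebuilds, these proofs, and the whole argument rests on the
-- fact that all of them are proof-irrelevant:
--   * the orders _<ᵀ_ and _<_ are irreflexive and proof-irrelevant, hence so
--     are their reflexive closures _≥ᵀ_ and _≥_ (a general fact about
--     reflexive closures of such relations), and hence so is isCNF;
--   * consequently an element of SigmaOrd is determined by its tree, and an
--     element of MutualOrd by its two exponents.

open import Defs
open import Function.Properties.Inverse.HalfAdjointEquivalence using (_≃_; ↔⇒≃)
open import Function.Bundles using (mk↔ₛ′)
open import Data.Sum using (_⊎_; inj₁; inj₂)
open import Data.Product using (_,_; proj₁)
open import Data.Product.Properties using (Σ-≡,≡→≡)
open import Data.Empty using (⊥-elim)
open import Relation.Nullary using (¬_)
open import Relation.Nullary.Irrelevant using (Irrelevant)
open import Axiom.UniquenessOfIdentityProofs.WithK using (uip)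
open import Relation.Binary.PropositionalEquality using (_≡_; refl; cong; cong₂; subst)

-- The reflexive closure "b ≺ a or a ≡ b" of an irreflexive, proof-irrelevant
-- relation is proof-irrelevant: the two summands exclude each other, and each
-- is irrelevant on its own (equality by uniqueness of identity proofs).
reflexive-closure-irrelevant :
  ∀ {A : Set} {_≺_ : A → A → Set} →
  (∀ {a} → ¬ (a ≺ a)) → (∀ {a b} → Irrelevant (a ≺ b)) →
  ∀ {a b} → Irrelevant ((b ≺ a) ⊎ (a ≡ b))
reflexive-closure-irrelevant irrefl irr (inj₁ p) (inj₁ q) = cong inj₁ (irr p q)
reflexive-closure-irrelevant irrefl irr (inj₁ p) (inj₂ refl) = ⊥-elim (irrefl p)
reflexive-closure-irrelevant irrefl irr (inj₂ refl) (inj₁ q) = ⊥-elim (irrefl q)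
reflexive-closure-irrelevant irrefl irr (inj₂ p) (inj₂ q) = cong inj₂ (uip p q)

<ᵀ-irrefl : ∀ {a} → ¬ (a <ᵀ a)
<ᵀ-irrefl (<₂ p) = <ᵀ-irrefl p
<ᵀ-irrefl (<₃ _ q) = <ᵀ-irrefl q

<ᵀ-irrelevant : ∀ {a b} → Irrelevant (a <ᵀ b)
<ᵀ-irrelevant <₁ <₁ = refl
<ᵀ-irrelevant (<₂ p) (<₂ q) = cong <₂ (<ᵀ-irrelevant p q)
<ᵀ-irrelevant (<₂ p) (<₃ refl q) = ⊥-elim (<ᵀ-irrefl p)
<ᵀ-irrelevant (<₃ refl p) (<₂ q) = ⊥-elim (<ᵀ-irrefl q)
<ᵀ-irrelevant (<₃ refl p) (<₃ refl q) = cong (<₃ refl) (<ᵀ-irrelevant p q)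

≥ᵀ-irrelevant : ∀ {a b} → Irrelevant (a ≥ᵀ b)
≥ᵀ-irrelevant = reflexive-closure-irrelevant <ᵀ-irrefl <ᵀ-irrelevant

isCNF-irrelevant : ∀ {a} → Irrelevant (isCNF a)
isCNF-irrelevant 𝟎IsCNF 𝟎IsCNF = refl
isCNF-irrelevant (ω^+IsCNF p₁ p₂ p₃) (ω^+IsCNF q₁ q₂ q₃)
  with isCNF-irrelevant p₁ q₁ | isCNF-irrelevant p₂ q₂ | ≥ᵀ-irrelevant p₃ q₃
... | refl | refl | refl = refl

SigmaOrd-≡ : {x y : SigmaOrd} → proj₁ x ≡ proj₁ y → x ≡ y
SigmaOrd-≡ {_ , c} {_ , c'} refl = Σ-≡,≡→≡ (refl , isCNF-irrelevant c c')

<-irrefl : ∀ {a} → ¬ (a < a)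
<-irrefl (<₂ p) = <-irrefl p
<-irrefl (<₃ _ q) = <-irrefl q

<-irrelevant : ∀ {a b} → Irrelevant (a < b)
<-irrelevant <₁ <₁ = refl
<-irrelevant (<₂ p) (<₂ q) = cong <₂ (<-irrelevant p q)
<-irrelevant (<₂ p) (<₃ refl q) = ⊥-elim (<-irrefl p)
<-irrelevant (<₃ refl p) (<₂ q) = ⊥-elim (<-irrefl q)
<-irrelevant (<₃ refl p) (<₃ refl q) = cong (<₃ refl) (<-irrelevant p q)

≥-irrelevant : ∀ {a b} → Irrelevant (a ≥ b)
≥-irrelevant = reflexive-closure-irrelevant <-irrefl <-irrelevant

ω^+-cong : ∀ {a a' b b' r r'} → a ≡ a' → b ≡ b' → ω^ a + b [ r ] ≡ ω^ a' + b' [ r' ]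
ω^+-cong {r = r} {r'} refl refl = cong (ω^ _ + _ [_]) (≥-irrelevant r r')

-- From SigmaOrd to MutualOrd: defined mutually with the proofs that it
-- preserves _<_ and _≥ fst_, which the MutualOrd constructor requires.

toMutual : (t : Tree) → isCNF t → MutualOrd
toMutual-< : ∀ {a c} (ca : isCNF a) (cc : isCNF c) →
             a <ᵀ c → toMutual a ca < toMutual c cc
toMutual-≥fst : ∀ {a b} (ca : isCNF a) (cb : isCNF b) →
                a ≥ᵀ fstᵀ b → toMutual a ca ≥ fst (toMutual b cb)

toMutual 𝟎 _ = 𝟎
toMutual (ω^ a + b) (ω^+IsCNF ca cb r) = ω^ toMutual a ca + toMutual b cb [ toMutual-≥fst ca cb r ]

toMutual-irrelevant : ∀ {a} (ca ca' : isCNF a) → toMutual a ca ≡ toMutual a ca'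
toMutual-irrelevant ca ca' = cong (toMutual _) (isCNF-irrelevant ca ca')

toMutual-< 𝟎IsCNF (ω^+IsCNF _ _ _) <₁ = <₁
toMutual-< (ω^+IsCNF ca _ _) (ω^+IsCNF cc _ _) (<₂ p) = <₂ (toMutual-< ca cc p)
toMutual-< (ω^+IsCNF ca _ _) (ω^+IsCNF cc _ _) (<₃ refl q) =
  <₃ (toMutual-irrelevant ca cc) (toMutual-< _ _ q)

toMutual-≥fst {𝟎} 𝟎IsCNF 𝟎IsCNF _ = inj₂ refl
toMutual-≥fst (ω^+IsCNF _ _ _) 𝟎IsCNF _ = inj₁ <₁
toMutual-≥fst ca (ω^+IsCNF cc _ _) (inj₁ p) = inj₁ (toMutual-< cc ca p)
toMutual-≥fst ca (ω^+IsCNF cc _ _) (inj₂ refl) = inj₂ (toMutual-irrelevant ca cc)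

-- From MutualOrd to SigmaOrd: forget the proofs, then show the resulting
-- tree is in normal form because the forgetful map preserves the order.

toTree : MutualOrd → Tree
toTree 𝟎 = 𝟎
toTree (ω^ a + b [ _ ]) = ω^ toTree a + toTree b

toTree-< : ∀ {a b} → a < b → toTree a <ᵀ toTree b
toTree-< <₁ = <₁
toTree-< (<₂ p) = <₂ (toTree-< p)
toTree-< (<₃ refl q) = <₃ refl (toTree-< q)

toTree-≥ : ∀ {a b} → a ≥ b → toTree a ≥ᵀ toTree b
toTree-≥ (inj₁ p) = inj₁ (toTree-< p)
toTree-≥ (inj₂ refl) = inj₂ refl

toTree-fst : ∀ a → toTree (fst a) ≡ fstᵀ (toTree a)
toTree-fst 𝟎 = refl
toTree-fst (ω^ _ + _ [ _ ]) = refl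

toTree-≥fst : ∀ a b → a ≥ fst b → toTree a ≥ᵀ fstᵀ (toTree b)
toTree-≥fst a b r = subst (toTree a ≥ᵀ_) (toTree-fst b) (toTree-≥ r)

toTree-isCNF : ∀ x → isCNF (toTree x)
toTree-isCNF 𝟎 = 𝟎IsCNF
toTree-isCNF (ω^ a + b [ r ]) = ω^+IsCNF (toTree-isCNF a) (toTree-isCNF b) (toTree-≥fst a b r)

toTree∘toMutual : ∀ t (c : isCNF t) → toTree (toMutual t c) ≡ t
toTree∘toMutual 𝟎 _ = refl
toTree∘toMutual (ω^ a + b) (ω^+IsCNF ca cb _) =
  cong₂ ω^_+_ (toTree∘toMutual a ca) (toTree∘toMutual b cb)

toMutual∘toTree : ∀ x → toMutual (toTree x) (toTree-isCNF x) ≡ x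
toMutual∘toTree 𝟎 = refl
toMutual∘toTree (ω^ a + b [ _ ]) = ω^+-cong (toMutual∘toTree a) (toMutual∘toTree b)

theorem3p3 : SigmaOrd ≃ MutualOrd
theorem3p3 = ↔⇒≃ (mk↔ₛ′ to from toMutual∘toTree from∘to)
  where
  to : SigmaOrd → MutualOrd
  to (t , c) = toMutual t c

  from : MutualOrd → SigmaOrd
  from x = toTree x , toTree-isCNF x

  from∘to : ∀ x → from (to x) ≡ x
  from∘to (t , c) = SigmaOrd-≡ (toTree∘toMutual t c)
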